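{- Let $t,t'$ be terms of the calculus $\lambda^{in}_\upsilon$ described in the context. If $t$ is linear and $t\to t'$, then $t'$ is linear.
   Context: Terms: $t::=\underline{n}\mid\lambda t\mid t\,t\mid t\langle i\rangle\mid t\{t,i\}$ with $n,i\in\mathbb{N}$ (here $t\langle i\rangle$ abbreviates the $\lambda\upsilon$ closure $t[\Uparrow^i(\uparrow)]$ and $t\{s,i\}$ abbreviates $t[\Uparrow^i(s/)]$). $\mathcal{L}$-types are finite lists of naturals. Partial merge $\ddagger$: $[]\ddagger \ell=\ell$; $(i::\ell)\ddagger []=i::\ell$; $(i_1::\ell_1)\ddagger(i_2::\ell_2)= i_1::(\ell_1\ddagger(i_2::\ell_2))$ if $i_1<i_2$, $=i_2::((i_1::\ell_1)\ddagger \ell_2)$ if $i_1>i_2$, undefined when the recursion reaches equal heads. Partial decrement $\downarrow$, defined only on lists with all elements $>0$: $\downarrow[]=[]$, $\downarrow((i+1)::\ell)=i::\downarrow\ell$. $\uparrow$ adds $1$ to every element, $\uparrow^i$ is its $i$-fold iterate. $(p\mid\ell)$ is the sublist of elements satisfying predicate $p$; $<i,>i,\geq i$ are the predicates $k<i$, $k>i$, $k\geq i$. Typing rules (each applicable only when its conclusion's lists are defined): $\underline{n}:[n]$; if $t:0::\ell$ then $\lambda t:\downarrow\ell$; if $t_1:\ell_1,t_2:\ell_2$ then $t_1t_2:\ell_1\ddagger\ell_2$; if $t:\ell$ then $t\langle i\rangle:(<i\mid\ell)\ddagger\uparrow(\geq i\mid\ell)$; if $t_1:\ell_1,t_2:\ell_2$,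 $i\in\ell_1$ then $t_1\{t_2,i\}:((<i\mid\ell_1)\ddagger\downarrow(>i\mid\ell_1))\ddagger\uparrow^i\ell_2$; if $t_1:\ell_1,t_2:\ell_2$, $i\notin\ell_1$ then $t_1\{t_2,i\}:(<i\mid\ell_1)\ddagger\downarrow(>i\mid\ell_1)$. A (closed) term $t$ is called linear if $t:[]$ is derivable. The reduction $\to$ is the closure under term contexts of the rules: $(\lambda t_1)t_2\to t_1\{t_2,0\}$; $(t_1t_2)\langle i\rangle\to t_1\langle i\rangle\,t_2\langle i\rangle$; $(t_1t_2)\{t_3,i\}\to t_1\{t_3,i\}\,t_2\{t_3,i\}$; $(\lambda t)\langle i\rangle\to\lambda(t\langle i+1\rangle)$; $(\lambda t_1)\{t_2,i\}\to\lambda(t_1\{t_2,i+1\})$; $\underline{0}\{t,0\}\to t$; $\underline{n+1}\{t,0\}\to\underline{n}$; $\underline{0}\{t,i+1\}\to\underline{0}$; $\underline{n+1}\{t,i+1\}\to\underline{n}\{t,i\}\langle 0\rangle$; $\underline{0}\langle i+1\rangle\to\underline{0}$; $\underline{n+1}\langle i+1\rangle\to\underline{n}\langle i\rangle\langle 0\rangle$; $\underline{n}\langle 0\rangle\to\underline{n+1}$. -}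

module Defs where

open import Data.Nat using (ℕ; zero; suc; _<ᵇ_; _≤ᵇ_)
open import Data.Nat.Properties using ()
open import Data.Bool using (Bool; true; false; not)
open import Data.List using (List; []; _∷_; map; filterᵇ)
open import Data.Maybe using (Maybe; just; nothing; _>>=_)
open import Relation.Binary.PropositionalEquality using (_≡_)

-- Terms of λ^{in}_υ (de Bruijn):
--   var n  = n̲ ;  lam t = λ t ;  app t s = t s ;
--   shift t i = t⟨i⟩  (t[⇑^i(↑)]) ;  sub t s i = t{s,i}  (t[⇑^i(s/)])
data Term : Set where
  var   : ℕ → Term
  lam   : Term → Term
  app   : Term → Term → Term
  shift : Term → ℕ → Term
  sub   : Term → Term → ℕ → Term

LType : Set
LType = List ℕ

merge : LType → LType → Maybe LType
merge [] l = just l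
merge (i₁ ∷ l₁) = go
  where
  go : LType → Maybe LType
  go [] = just (i₁ ∷ l₁)
  go (i₂ ∷ l₂) with i₁ <ᵇ i₂ | i₂ <ᵇ i₁
  ... | true  | _     = merge l₁ (i₂ ∷ l₂) >>= λ r → just (i₁ ∷ r)
  ... | false | true  = go l₂ >>= λ r → just (i₂ ∷ r)
  ... | false | false = nothing

dec : LType → Maybe LType
dec [] = just []
dec (zero ∷ l) = nothing
dec (suc i ∷ l) = dec l >>= λ r → just (i ∷ r)

up : LType → LType
up = map suc

upN : ℕ → LType → LType
upN zero l = l
upN (suc i) l = up (upN i l)

ltF : ℕ → LType → LType
ltF i = filterᵇ (λ k → k <ᵇ i)

gtF : ℕ → LType → LType
gtF i = filterᵇ (λ k → i <ᵇ k)

geF : ℕ → LType → LType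
geF i = filterᵇ (λ k → i ≤ᵇ k)

_∈ᵇ_ : ℕ → LType → Bool
i ∈ᵇ [] = false
i ∈ᵇ (k ∷ l) with i ≤ᵇ k | k ≤ᵇ i
... | true | true = true
... | _    | _    = i ∈ᵇ l

data _∶_ : Term → LType → Set where
  ty-var : ∀ n → var n ∶ (n ∷ [])
  ty-lam : ∀ {t ℓ ℓ'} → t ∶ (0 ∷ ℓ) → dec ℓ ≡ just ℓ' → lam t ∶ ℓ'
  ty-app : ∀ {t₁ t₂ ℓ₁ ℓ₂ ℓ} → t₁ ∶ ℓ₁ → t₂ ∶ ℓ₂ →
           merge ℓ₁ ℓ₂ ≡ just ℓ → app t₁ t₂ ∶ ℓ
  ty-shift : ∀ {t ℓ ℓ'} i → t ∶ ℓ →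
           merge (ltF i ℓ) (up (geF i ℓ)) ≡ just ℓ' → shift t i ∶ ℓ'
  ty-sub-in : ∀ {t₁ t₂ ℓ₁ ℓ₂ d m ℓ} i → t₁ ∶ ℓ₁ → t₂ ∶ ℓ₂ →
           i ∈ᵇ ℓ₁ ≡ true →
           dec (gtF i ℓ₁) ≡ just d →
           merge (ltF i ℓ₁) d ≡ just m →
           merge m (upN i ℓ₂) ≡ just ℓ → sub t₁ t₂ i ∶ ℓ
  ty-sub-out : ∀ {t₁ t₂ ℓ₁ ℓ₂ d ℓ} i → t₁ ∶ ℓ₁ → t₂ ∶ ℓ₂ →
           i ∈ᵇ ℓ₁ ≡ false →
           dec (gtF i ℓ₁) ≡ just d →
           merge (ltF i ℓ₁) d ≡ just ℓ → sub t₁ t₂ i ∶ ℓ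

Linear : Term → Set
Linear t = t ∶ []

data _⟶_ : Term → Term → Set where
  beta      : ∀ t₁ t₂ → app (lam t₁) t₂ ⟶ sub t₁ t₂ 0
  shift-app : ∀ t₁ t₂ i → shift (app t₁ t₂) i ⟶ app (shift t₁ i) (shift t₂ i)
  sub-app   : ∀ t₁ t₂ t₃ i → sub (app t₁ t₂) t₃ i ⟶ app (sub t₁ t₃ i) (sub t₂ t₃ i)
  shift-lam : ∀ t i → shift (lam t) i ⟶ lam (shift t (suc i))
  sub-lam   : ∀ t₁ t₂ i → sub (lam t₁) t₂ i ⟶ lam (sub t₁ t₂ (suc i))
  sub-0-0   : ∀ t → sub (var 0) t 0 ⟶ t
  sub-S-0   : ∀ n t → sub (var (suc n)) t 0 ⟶ var n
  sub-0-S   : ∀ t i → sub (var 0) t (suc i) ⟶ var 0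
  sub-S-S   : ∀ n t i → sub (var (suc n)) t (suc i) ⟶ shift (sub (var n) t i) 0
  shift-0-S : ∀ i → shift (var 0) (suc i) ⟶ var 0
  shift-S-S : ∀ n i → shift (var (suc n)) (suc i) ⟶ shift (shift (var n) i) 0
  shift-0   : ∀ n → shift (var n) 0 ⟶ var (suc n)
  c-lam    : ∀ {t t'} → t ⟶ t' → lam t ⟶ lam t'
  c-appˡ   : ∀ {t t' s} → t ⟶ t' → app t s ⟶ app t' s
  c-appʳ   : ∀ {t s s'} → s ⟶ s' → app t s ⟶ app t s'
  c-shift  : ∀ {t t' i} → t ⟶ t' → shift t i ⟶ shift t' i
  c-subˡ   : ∀ {t t' s i} → t ⟶ t' → sub t s i ⟶ sub t' s i
  c-subʳ   : ∀ {t s s' i} → s ⟶ s' → sub t s i ⟶ sub t s' i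

-- Read an L-type as the set of its elements. Every derivable L-type is strictly
-- increasing, hence determined by that set, and on such lists ‡ is disjoint union
-- (defined exactly when the arguments are disjoint) while ↓, ↑ and the filters
-- act pointwise on indices. So the typing rules can be restated on sets (t ⊨ R),
-- where the types of t⟨i⟩ and t{s,i} are computed by reindexings mirroring
-- ⇑^i(↑) and ⇑^i(s/). Each reduction rule preserves the set of its redex, because
-- reindexings commute with unions and preserve disjointness; the reduct is then
-- typable with a sorted list having the same elements, i.e. with the same L-type.
module Submission where

open import Defs
open import Algebra.Bundles using (CommutativeMonoid)
open import Data.Bool using (Bool; true; false; T; T?; _∧_; _∨_)
open import Data.Bool.Properties
  using (T-∨; T-∧; T-≡; ∨-identityʳ; ∧-zeroʳ; ∨-assoc; ∨-commutativeMonoid; ∧-distribʳ-∨)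
open import Algebra.Properties.CommutativeSemigroup
  (CommutativeMonoid.commutativeSemigroup ∨-commutativeMonoid) using (x∙yz≈y∙xz; interchange)
open import Data.Empty using (⊥; ⊥-elim)
open import Data.List using ([]; _∷_; filterᵇ)
open import Data.Maybe using (Maybe; just; nothing; _>>=_)
open import Data.Nat using (ℕ; zero; suc; _<ᵇ_; _≤ᵇ_; _≡ᵇ_; _<_; _≤_; s<s; s≤s⁻¹; s<s⁻¹)
open import Data.Nat.Properties
  using (≡ᵇ⇒≡; ≡⇒≡ᵇ; <ᵇ⇒<; <⇒<ᵇ; ≤ᵇ⇒≤; ≮⇒≥; ≤-antisym; <-irrefl; <-≤-trans; <⇒≱; <⇒≤; ≤-refl
        ; m≤n⇒m≤1+n; n≤0⇒n≡0)
open import Data.Product using (∃-syntax; _×_; _,_; proj₁; proj₂)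
open import Data.Sum as Sum using (_⊎_; inj₁; inj₂)
open import Data.List.Membership.Propositional using (_∈_)
open import Data.List.Relation.Binary.Disjoint.Propositional using (Disjoint; contractₗ; contractᵣ)
open import Data.List.Relation.Binary.Subset.Propositional using (_⊆_)
open import Data.List.Relation.Unary.All as All using (All)
open import Data.List.Relation.Unary.AllPairs as AllPairs using (AllPairs; []; _∷_)
open import Data.List.Relation.Unary.AllPairs.Properties using (map⁺; filter⁺)
open import Data.List.Membership.Propositional.Properties using (∈-filter⁺; ∈-filter⁻)
open import Data.List.Relation.Unary.Any using (here; there)
open import Relation.Nullary using (¬_)
open import Function using (_∘_; id; Equivalence)
open import Relation.Binary.PropositionalEquality

open Equivalence using (to; from)

Indices : Set
Indices = ℕ → Bool

_∈ˢ_ : ℕ → Indices → Set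
k ∈ˢ P = T (P k)

_⊆ˢ_ : Indices → Indices → Set
P ⊆ˢ Q = ∀ k → k ∈ˢ P → k ∈ˢ Q

∅ : Indices
∅ _ = false

_∪_ : Indices → Indices → Indices
(P ∪ Q) k = P k ∨ Q k

_∩_ : Indices → Indices → Indices
(P ∩ Q) k = P k ∧ Q k

_when_ : Indices → Bool → Indices
(P when b) k = b ∧ P k

Disjointˢ : Indices → Indices → Set
Disjointˢ P Q = ∀ k → k ∈ˢ P → k ∈ˢ Q → ⊥

∈-∪⁺ˡ : ∀ {P Q} → P ⊆ˢ (P ∪ Q)
∈-∪⁺ˡ _ = from T-∨ ∘ inj₁

∈-∪⁺ʳ : ∀ {P Q} → Q ⊆ˢ (P ∪ Q)
∈-∪⁺ʳ _ = from T-∨ ∘ inj₂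

≗⇒⊆ : ∀ {P Q} → P ≗ Q → P ⊆ˢ Q
≗⇒⊆ P≗Q k = subst T (P≗Q k)

when-⊆ : ∀ P {b} → (P when b) ⊆ˢ P
when-⊆ _ _ = proj₂ ∘ to T-∧

when-mono : ∀ P {a b} → (T a → T b) → (P when a) ⊆ˢ (P when b)
when-mono _ a⇒b _ k∈ = let a , k∈P = to T-∧ k∈ in from T-∧ (a⇒b a , k∈P)

when-T : ∀ P {b} → T b → (P when b) ≗ P
when-T _ {true} _ _ = refl

T-extensional : ∀ {a b} → (T a → T b) → (T b → T a) → a ≡ b
T-extensional {false} {false} _ _ = refl
T-extensional {false} {true} _ b⇒a = ⊥-elim (b⇒a _)
T-extensional {true} {false} a⇒b _ = ⊥-elim (a⇒b _)
T-extensional {true} {true} _ _ = refl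

disjoint-mono : ∀ {P P' Q Q'} → P' ⊆ˢ P → Q' ⊆ˢ Q → Disjointˢ P Q → Disjointˢ P' Q'
disjoint-mono P'⊆P Q'⊆Q P⊥Q k p q = P⊥Q k (P'⊆P k p) (Q'⊆Q k q)

Reindexing : (Indices → Indices) → Set
Reindexing F = ∀ k → (∀ P → F P k ≡ false) ⊎ ∃[ j ] (∀ P → F P k ≡ P j)

module _ {F : Indices → Indices} (F-reindexing : Reindexing F) where

  reindex-cong : ∀ {P Q} → P ≗ Q → F P ≗ F Q
  reindex-cong {P} {Q} P≗Q k with F-reindexing k
  ... | inj₁ empty = trans (empty P) (sym (empty Q))
  ... | inj₂ (j , at) = trans (at P) (trans (P≗Q j) (sym (at Q)))

  reindex-∪ : ∀ P Q → F (P ∪ Q) ≗ F P ∪ F Q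
  reindex-∪ P Q k with F-reindexing k
  ... | inj₁ empty = trans (empty _) (sym (cong₂ _∨_ (empty P) (empty Q)))
  ... | inj₂ (j , at) = trans (at _) (sym (cong₂ _∨_ (at P) (at Q)))

  reindex-∅ : F ∅ ≗ ∅
  reindex-∅ k with F-reindexing k
  ... | inj₁ empty = empty ∅
  ... | inj₂ (j , at) = at ∅

  reindex-mono : ∀ {P Q} → P ⊆ˢ Q → F P ⊆ˢ F Q
  reindex-mono {P} {Q} P⊆Q k p with F-reindexing k
  ... | inj₁ empty = ⊥-elim (subst T (empty P) p)
  ... | inj₂ (j , at) = subst T (sym (at Q)) (P⊆Q j (subst T (at P) p))

  reindex-disjoint : ∀ {P Q} → Disjointˢ P Q → Disjointˢ (F P) (F Q)
  reindex-disjoint {P} {Q} P⊥Q k p q with F-reindexing k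
  ... | inj₁ empty = subst T (empty P) p
  ... | inj₂ (j , at) = P⊥Q j (subst T (at P) p) (subst T (at Q) q)

-- Free-index sets of t⟨i⟩ and of the first argument of t{s,i}: upˢ, shiftˢ
-- and removeˢ follow ↑, ⇑^i(↑) and ⇑^i(s/), liftˢ being the action of ⇑.
upˢ : Indices → Indices
upˢ P zero = false
upˢ P (suc k) = P k

upNˢ : ℕ → Indices → Indices
upNˢ zero P = P
upNˢ (suc i) P = upˢ (upNˢ i P)

liftˢ : (Indices → Indices) → Indices → Indices
liftˢ F P zero = P zero
liftˢ F P (suc k) = F (P ∘ suc) k

shiftˢ : ℕ → Indices → Indices
shiftˢ zero = upˢ
shiftˢ (suc i) = liftˢ (shiftˢ i)

removeˢ : ℕ → Indices → Indices
removeˢ zero P = P ∘ suc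
removeˢ (suc i) = liftˢ (removeˢ i)

-- Both typing rules of t{s,i} at once: s contributes only when i occurs in t.
substˢ : ℕ → Indices → Indices → Indices
substˢ i P Q = removeˢ i P ∪ (upNˢ i Q when P i)

upˢ-reindexing : Reindexing upˢ
upˢ-reindexing zero = inj₁ λ _ → refl
upˢ-reindexing (suc k) = inj₂ (k , λ _ → refl)

∘-reindexing : ∀ {F G} → Reindexing F → Reindexing G → Reindexing (F ∘ G)
∘-reindexing {F} {G} F-reindexing G-reindexing k with F-reindexing k
... | inj₁ empty = inj₁ (empty ∘ G)
... | inj₂ (j , at) with G-reindexing j
...   | inj₁ empty = inj₁ λ P → trans (at (G P)) (empty P)
...   | inj₂ (j' , at') = inj₂ (j' , λ P → trans (at (G P)) (at' P))

liftˢ-reindexing : ∀ {F} → Reindexing F → Reindexing (liftˢ F)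
liftˢ-reindexing F-reindexing zero = inj₂ (zero , λ _ → refl)
liftˢ-reindexing F-reindexing (suc k) with F-reindexing k
... | inj₁ empty = inj₁ (empty ∘ (_∘ suc))
... | inj₂ (j , at) = inj₂ (suc j , at ∘ (_∘ suc))

upNˢ-reindexing : ∀ i → Reindexing (upNˢ i)
upNˢ-reindexing zero k = inj₂ (k , λ _ → refl)
upNˢ-reindexing (suc i) = ∘-reindexing upˢ-reindexing (upNˢ-reindexing i)

shiftˢ-reindexing : ∀ i → Reindexing (shiftˢ i)
shiftˢ-reindexing zero = upˢ-reindexing
shiftˢ-reindexing (suc i) = liftˢ-reindexing (shiftˢ-reindexing i)

removeˢ-reindexing : ∀ i → Reindexing (removeˢ i)
removeˢ-reindexing zero k = inj₂ (suc k , λ _ → refl)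
removeˢ-reindexing (suc i) = liftˢ-reindexing (removeˢ-reindexing i)

substˢ-cong : ∀ i {P P'} Q → P ≗ P' → substˢ i P Q ≗ substˢ i P' Q
substˢ-cong i Q P≗P' k =
  cong₂ _∨_ (reindex-cong (removeˢ-reindexing i) P≗P' k) (cong (_∧ upNˢ i Q k) (P≗P' i))

substˢ-in : ∀ i {P Q} → P i ≡ true → substˢ i P Q ≗ removeˢ i P ∪ upNˢ i Q
substˢ-in i Pi k rewrite Pi = refl

substˢ-out : ∀ i {P Q} → P i ≡ false → substˢ i P Q ≗ removeˢ i P
substˢ-out i Pi k rewrite Pi = ∨-identityʳ _

substˢ-∪ : ∀ i P₁ P₂ Q → substˢ i (P₁ ∪ P₂) Q ≗ substˢ i P₁ Q ∪ substˢ i P₂ Q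
substˢ-∪ i P₁ P₂ Q k = begin
  removeˢ i (P₁ ∪ P₂) k ∨ ((P₁ i ∨ P₂ i) ∧ U)
    ≡⟨ cong₂ _∨_ (reindex-∪ (removeˢ-reindexing i) P₁ P₂ k) (∧-distribʳ-∨ U (P₁ i) (P₂ i)) ⟩
  (removeˢ i P₁ k ∨ removeˢ i P₂ k) ∨ ((P₁ i ∧ U) ∨ (P₂ i ∧ U))
    ≡⟨ interchange (removeˢ i P₁ k) (removeˢ i P₂ k) _ _ ⟩
  substˢ i P₁ Q k ∨ substˢ i P₂ Q k ∎
  where
  open ≡-Reasoning
  U = upNˢ i Q k

-- Exactly when the final merge in the typing of t{s,i} is defined.
Substitutable : ℕ → Indices → Indices → Set
Substitutable i P Q = Disjointˢ (removeˢ i P) (upNˢ i Q when P i)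

substitutable-mono : ∀ i {P P' Q} → P' ⊆ˢ P → Substitutable i P Q → Substitutable i P' Q
substitutable-mono i {Q = Q} P'⊆P =
  disjoint-mono (reindex-mono (removeˢ-reindexing i) P'⊆P) (when-mono (upNˢ i Q) (P'⊆P i))

substitutable-suc : ∀ i {P Q} → Substitutable i (P ∘ suc) Q → Substitutable (suc i) P Q
substitutable-suc i ok zero _ k∈ = proj₂ (to T-∧ k∈)
substitutable-suc i ok (suc k) = ok k

substitutable-suc⁻ : ∀ i {P Q} → Substitutable (suc i) P Q → Substitutable i (P ∘ suc) Q
substitutable-suc⁻ i ok = ok ∘ suc

substˢ-disjoint : ∀ i {P₁ P₂ Q} → Disjointˢ P₁ P₂ → Substitutable i (P₁ ∪ P₂) Q →
                  Disjointˢ (substˢ i P₁ Q) (substˢ i P₂ Q)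
substˢ-disjoint i {P₁} {P₂} {Q} P₁#P₂ ok k k∈₁ k∈₂ with to T-∨ k∈₁ | to T-∨ k∈₂
... | inj₁ r₁ | inj₁ r₂ = reindex-disjoint (removeˢ-reindexing i) P₁#P₂ k r₁ r₂
... | inj₁ r₁ | inj₂ u₂ =
  ok k (reindex-mono (removeˢ-reindexing i) ∈-∪⁺ˡ k r₁)
       (when-mono (upNˢ i Q) (∈-∪⁺ʳ {P₁} {P₂} i) k u₂)
... | inj₂ u₁ | inj₁ r₂ =
  ok k (reindex-mono (removeˢ-reindexing i) ∈-∪⁺ʳ k r₂)
       (when-mono (upNˢ i Q) (∈-∪⁺ˡ {P₁} {P₂} i) k u₁)
... | inj₂ u₁ | inj₂ u₂ = P₁#P₂ i (proj₁ (to T-∧ u₁)) (proj₁ (to T-∧ u₂))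

≤ᵇ≡<ᵇ-suc : ∀ i k → (i ≤ᵇ k) ≡ (i <ᵇ suc k)
≤ᵇ≡<ᵇ-suc zero k = refl
≤ᵇ≡<ᵇ-suc (suc i) k = refl

shiftˢ-split : ∀ i P → ((_<ᵇ i) ∩ P) ∪ upˢ ((i ≤ᵇ_) ∩ P) ≗ shiftˢ i P
shiftˢ-split zero P zero = refl
shiftˢ-split zero P (suc k) = refl
shiftˢ-split (suc i) P zero = ∨-identityʳ (P zero)
shiftˢ-split (suc i) P (suc k) =
  trans (cong (((k <ᵇ i) ∧ P (suc k)) ∨_) (upper k)) (shiftˢ-split i (P ∘ suc) k)
  where
  upper : ∀ k → (i <ᵇ k) ∧ P k ≡ upˢ ((i ≤ᵇ_) ∩ (P ∘ suc)) k
  upper zero = refl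
  upper (suc k) = cong (_∧ P (suc k)) (sym (≤ᵇ≡<ᵇ-suc i k))

shiftˢ-split-disjoint : ∀ i P → Disjointˢ ((_<ᵇ i) ∩ P) (upˢ ((i ≤ᵇ_) ∩ P))
shiftˢ-split-disjoint i P (suc k) below above =
  <⇒≱ (<ᵇ⇒< (suc k) i (proj₁ (to T-∧ below))) (m≤n⇒m≤1+n (≤ᵇ⇒≤ i k (proj₁ (to T-∧ above))))

removeˢ-split : ∀ i P → ((_<ᵇ i) ∩ P) ∪ (((i <ᵇ_) ∩ P) ∘ suc) ≗ removeˢ i P
removeˢ-split zero P k = refl
removeˢ-split (suc i) P zero = ∨-identityʳ (P zero)
removeˢ-split (suc i) P (suc k) = removeˢ-split i (P ∘ suc) k

removeˢ-split-disjoint : ∀ i P → Disjointˢ ((_<ᵇ i) ∩ P) (((i <ᵇ_) ∩ P) ∘ suc)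
removeˢ-split-disjoint i P k below above =
  <⇒≱ (<ᵇ⇒< k i (proj₁ (to T-∧ below))) (s≤s⁻¹ (<ᵇ⇒< i (suc k) (proj₁ (to T-∧ above))))

Sorted : LType → Set
Sorted = AllPairs _<_

⟦_⟧ : LType → Indices
⟦ [] ⟧ k = false
⟦ x ∷ l ⟧ k = (k ≡ᵇ x) ∨ ⟦ l ⟧ k

∈⇒∈ˢ : ∀ {k l} → k ∈ l → k ∈ˢ ⟦ l ⟧
∈⇒∈ˢ {k} (here refl) = from T-∨ (inj₁ (≡⇒≡ᵇ k k refl))
∈⇒∈ˢ (there k∈l) = from T-∨ (inj₂ (∈⇒∈ˢ k∈l))

∈ˢ⇒∈ : ∀ {k} l → k ∈ˢ ⟦ l ⟧ → k ∈ l
∈ˢ⇒∈ {k} (x ∷ l) k∈ with to T-∨ k∈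
... | inj₁ k≡x = here (≡ᵇ⇒≡ k x k≡x)
... | inj₂ k∈l = there (∈ˢ⇒∈ l k∈l)

⟦⟧-≗ : ∀ l {P} → (∀ {k} → k ∈ l → k ∈ˢ P) → (∀ {k} → k ∈ˢ P → k ∈ l) → ⟦ l ⟧ ≗ P
⟦⟧-≗ l ⊆P P⊆ k = T-extensional (⊆P ∘ ∈ˢ⇒∈ l) (∈⇒∈ˢ ∘ P⊆)

disjointˢ⇒disjoint : ∀ A B → Disjointˢ ⟦ A ⟧ ⟦ B ⟧ → Disjoint A B
disjointˢ⇒disjoint _ _ A#B {k} (k∈A , k∈B) = A#B k (∈⇒∈ˢ k∈A) (∈⇒∈ˢ k∈B)

disjoint⇒disjointˢ : ∀ A B → Disjoint A B → Disjointˢ ⟦ A ⟧ ⟦ B ⟧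
disjoint⇒disjointˢ A B A#B _ k∈A k∈B = A#B (∈ˢ⇒∈ A k∈A , ∈ˢ⇒∈ B k∈B)

head-≤ : ∀ {x l k} → Sorted (x ∷ l) → k ∈ x ∷ l → x ≤ k
head-≤ _ (here refl) = ≤-refl
head-≤ (x<l ∷ _) (there k∈l) = <⇒≤ (All.lookup x<l k∈l)

sorted-⊆-antisym : ∀ {A B} → Sorted A → Sorted B → A ⊆ B → B ⊆ A → A ≡ B
sorted-⊆-antisym [] [] _ _ = refl
sorted-⊆-antisym [] (_ ∷ _) _ B⊆A with B⊆A (here refl)
... | ()
sorted-⊆-antisym (_ ∷ _) [] A⊆B _ with A⊆B (here refl)
... | ()
sorted-⊆-antisym {x ∷ A} {y ∷ B} sA@(x<A ∷ sA') sB@(y<B ∷ sB') A⊆B B⊆A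
  with ≤-antisym (head-≤ sA (B⊆A (here refl))) (head-≤ sB (A⊆B (here refl)))
... | refl = cong (x ∷_) (sorted-⊆-antisym sA' sB' (tail-⊆ x<A A⊆B) (tail-⊆ y<B B⊆A))
  where
  tail-⊆ : ∀ {C D} → All (x <_) C → (x ∷ C) ⊆ (x ∷ D) → C ⊆ D
  tail-⊆ x<C x∷C⊆x∷D k∈C with x∷C⊆x∷D (there k∈C)
  ... | here refl = ⊥-elim (<-irrefl refl (All.lookup x<C k∈C))
  ... | there k∈D = k∈D

⟦⟧-injective : ∀ {A B} → Sorted A → Sorted B → ⟦ A ⟧ ≗ ⟦ B ⟧ → A ≡ B
⟦⟧-injective {A} {B} sA sB A≗B =
  sorted-⊆-antisym sA sB (λ {k} → ∈ˢ⇒∈ B ∘ ≗⇒⊆ A≗B k ∘ ∈⇒∈ˢ)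
                         (λ {k} → ∈ˢ⇒∈ A ∘ ≗⇒⊆ (sym ∘ A≗B) k ∘ ∈⇒∈ˢ)

bind-cons : ∀ {m : Maybe LType} x → ∃[ r ] m ≡ just r → ∃[ C ] (m >>= λ r → just (x ∷ r)) ≡ just C
bind-cons x (r , refl) = x ∷ r , refl

bind-cons⁻ : ∀ (m : Maybe LType) x {C} → (m >>= λ r → just (x ∷ r)) ≡ just C →
             ∃[ r ] m ≡ just r × C ≡ x ∷ r
bind-cons⁻ (just r) x refl = r , refl , refl

data MergeStep (x : ℕ) (A : LType) (y : ℕ) (B : LType) : Maybe LType → Set where
  left  : x < y → MergeStep x A y B (merge A (y ∷ B) >>= λ r → just (x ∷ r))
  right : y < x → MergeStep x A y B (merge (x ∷ A) B >>= λ r → just (y ∷ r))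
  clash : x ≡ y → MergeStep x A y B nothing

merge-step : ∀ x A y B → MergeStep x A y B (merge (x ∷ A) (y ∷ B))
merge-step x A y B with x <ᵇ y in x<y | y <ᵇ x in y<x
... | true  | _     = left (<ᵇ⇒< x y (from T-≡ x<y))
... | false | true  = right (<ᵇ⇒< y x (from T-≡ y<x))
... | false | false = clash (≤-antisym (≮⇒≥ (≡false⇒≮ y<x)) (≮⇒≥ (≡false⇒≮ x<y)))
  where
  ≡false⇒≮ : ∀ {m n} → (m <ᵇ n) ≡ false → ¬ m < n
  ≡false⇒≮ m≮n m<n = subst T m≮n (<⇒<ᵇ m<n)

merge-⟦⟧ : ∀ A B {C} → merge A B ≡ just C → ⟦ C ⟧ ≗ ⟦ A ⟧ ∪ ⟦ B ⟧
merge-⟦⟧ [] B refl k = refl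
merge-⟦⟧ (x ∷ A) [] refl k = sym (∨-identityʳ _)
merge-⟦⟧ (x ∷ A) (y ∷ B) e k with merge (x ∷ A) (y ∷ B) | merge-step x A y B
... | _ | left _ with bind-cons⁻ (merge A (y ∷ B)) x e
...   | r , e' , refl =
  trans (cong ((k ≡ᵇ x) ∨_) (merge-⟦⟧ A (y ∷ B) e' k)) (sym (∨-assoc (k ≡ᵇ x) _ _))
merge-⟦⟧ (x ∷ A) (y ∷ B) e k | _ | right _ with bind-cons⁻ (merge (x ∷ A) B) y e
...   | r , e' , refl =
  trans (cong ((k ≡ᵇ y) ∨_) (merge-⟦⟧ (x ∷ A) B e' k)) (x∙yz≈y∙xz (k ≡ᵇ y) (⟦ x ∷ A ⟧ k) (⟦ B ⟧ k))
merge-⟦⟧ (x ∷ A) (y ∷ B) () k | _ | clash _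

merge-∈⁻ : ∀ A B {C k} → merge A B ≡ just C → k ∈ C → k ∈ A ⊎ k ∈ B
merge-∈⁻ A B e k∈C = Sum.map (∈ˢ⇒∈ A) (∈ˢ⇒∈ B) (to T-∨ (≗⇒⊆ (merge-⟦⟧ A B e) _ (∈⇒∈ˢ k∈C)))

merge-sorted : ∀ {A B C} → Sorted A → Sorted B → merge A B ≡ just C → Sorted C
merge-sorted {[]} _ sB refl = sB
merge-sorted {_ ∷ _} {[]} sA _ refl = sA
merge-sorted {x ∷ A} {y ∷ B} sA@(x<A ∷ sA') sB@(y<B ∷ sB') e
  with merge (x ∷ A) (y ∷ B) | merge-step x A y B
... | _ | left x<y with bind-cons⁻ (merge A (y ∷ B)) x e
...   | r , e' , refl = All.tabulate below ∷ merge-sorted sA' sB e'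
  where
  below : ∀ {k} → k ∈ r → x < k
  below k∈r with merge-∈⁻ A (y ∷ B) e' k∈r
  ... | inj₁ k∈A = All.lookup x<A k∈A
  ... | inj₂ k∈yB = <-≤-trans x<y (head-≤ sB k∈yB)
merge-sorted {x ∷ A} {y ∷ B} sA@(x<A ∷ sA') sB@(y<B ∷ sB') e | _ | right y<x
  with bind-cons⁻ (merge (x ∷ A) B) y e
...   | r , e' , refl = All.tabulate below ∷ merge-sorted sA sB' e'
  where
  below : ∀ {k} → k ∈ r → y < k
  below k∈r with merge-∈⁻ (x ∷ A) B e' k∈r
  ... | inj₁ k∈xA = <-≤-trans y<x (head-≤ sA k∈xA)
  ... | inj₂ k∈B = All.lookup y<B k∈B
merge-sorted {x ∷ A} {y ∷ B} _ _ () | _ | clash _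

merge-disjoint : ∀ {A B C} → Sorted A → Sorted B → merge A B ≡ just C → Disjoint A B
merge-disjoint {[]} _ _ _ (() , _)
merge-disjoint {_ ∷ _} {[]} _ _ _ (_ , ())
merge-disjoint {x ∷ A} {y ∷ B} sA@(_ ∷ sA') sB@(_ ∷ sB') e
  with merge (x ∷ A) (y ∷ B) | merge-step x A y B
... | _ | left x<y with bind-cons⁻ (merge A (y ∷ B)) x e
...   | _ , e' , refl = λ
  { (here refl , k∈yB) → <⇒≱ x<y (head-≤ sB k∈yB)
  ; (there k∈A , k∈yB) → merge-disjoint sA' sB e' (k∈A , k∈yB) }
merge-disjoint {x ∷ A} {y ∷ B} sA@(_ ∷ sA') sB@(_ ∷ sB') e | _ | right y<x
  with bind-cons⁻ (merge (x ∷ A) B) y e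
...   | _ , e' , refl = λ
  { (k∈xA , here refl) → <⇒≱ y<x (head-≤ sA k∈xA)
  ; (k∈xA , there k∈B) → merge-disjoint sA sB' e' (k∈xA , k∈B) }
merge-disjoint {x ∷ A} {y ∷ B} _ _ () | _ | clash _

-- The inner recursion mirrors merge's own go: the termination checker does not
-- accept the lexicographic recursion on (A , B) through a with.
merge-defined : ∀ A B → Sorted A → Sorted B → Disjoint A B → ∃[ C ] merge A B ≡ just C
merge-defined [] B _ _ _ = B , refl
merge-defined (x ∷ A) B₀ (x<A ∷ sA) sB₀ A#B₀ = go B₀ sB₀ A#B₀
  where
  go : ∀ B → Sorted B → Disjoint (x ∷ A) B → ∃[ C ] merge (x ∷ A) B ≡ just C
  go [] _ _ = x ∷ A , refl
  go (y ∷ B) sB@(_ ∷ sB') A#B with merge (x ∷ A) (y ∷ B) | merge-step x A y B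
  ... | _ | left _ = bind-cons x (merge-defined A (y ∷ B) sA sB (contractₗ A#B))
  ... | _ | right _ = bind-cons y (go B sB' (contractᵣ A#B))
  ... | _ | clash refl = ⊥-elim (A#B (here refl , here refl))

dec-⟦⟧ : ∀ l {d} → dec l ≡ just d → ⟦ d ⟧ ≗ ⟦ l ⟧ ∘ suc
dec-⟦⟧ [] refl k = refl
dec-⟦⟧ (suc i ∷ l) e k with bind-cons⁻ (dec l) i e
... | _ , e' , refl = cong ((k ≡ᵇ i) ∨_) (dec-⟦⟧ l e' k)

dec-∈⁻ : ∀ l {d k} → dec l ≡ just d → k ∈ d → suc k ∈ l
dec-∈⁻ [] refl ()
dec-∈⁻ (suc i ∷ l) e k∈d with bind-cons⁻ (dec l) i e
dec-∈⁻ (suc i ∷ l) e (here refl) | _ , _ , refl = here refl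
dec-∈⁻ (suc i ∷ l) e (there k∈d) | _ , e' , refl = there (dec-∈⁻ l e' k∈d)

dec-sorted : ∀ {l d} → Sorted l → dec l ≡ just d → Sorted d
dec-sorted [] refl = []
dec-sorted {suc i ∷ l} (i<l ∷ sl) e with bind-cons⁻ (dec l) i e
... | _ , e' , refl = All.tabulate (s<s⁻¹ ∘ All.lookup i<l ∘ dec-∈⁻ l e') ∷ dec-sorted sl e'

dec-defined : ∀ l → ¬ 0 ∈ l → ∃[ d ] dec l ≡ just d
dec-defined [] _ = [] , refl
dec-defined (zero ∷ l) 0∉ = ⊥-elim (0∉ (here refl))
dec-defined (suc i ∷ l) 0∉ = bind-cons i (dec-defined l (0∉ ∘ there))

filterᵇ-⟦⟧ : ∀ p l → ⟦ filterᵇ p l ⟧ ≗ p ∩ ⟦ l ⟧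
filterᵇ-⟦⟧ p l = ⟦⟧-≗ (filterᵇ p l)
  (λ k∈ → let k∈l , pk = ∈-filter⁻ (T? ∘ p) {xs = l} k∈ in from T-∧ (pk , ∈⇒∈ˢ k∈l))
  (λ {k} k∈ → let pk , k∈l = to (T-∧ {p k}) k∈ in ∈-filter⁺ (T? ∘ p) (∈ˢ⇒∈ l k∈l) pk)

filterᵇ-sorted : ∀ p {l} → Sorted l → Sorted (filterᵇ p l)
filterᵇ-sorted p = filter⁺ (T? ∘ p)

up-⟦⟧ : ∀ l → ⟦ up l ⟧ ≗ upˢ ⟦ l ⟧
up-⟦⟧ [] zero = refl
up-⟦⟧ [] (suc k) = refl
up-⟦⟧ (x ∷ l) zero = up-⟦⟧ l zero
up-⟦⟧ (x ∷ l) (suc k) = cong ((k ≡ᵇ x) ∨_) (up-⟦⟧ l (suc k))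

upN-⟦⟧ : ∀ i l → ⟦ upN i l ⟧ ≗ upNˢ i ⟦ l ⟧
upN-⟦⟧ zero l k = refl
upN-⟦⟧ (suc i) l k = trans (up-⟦⟧ (upN i l) k) (reindex-cong upˢ-reindexing (upN-⟦⟧ i l) k)

up-sorted : ∀ {l} → Sorted l → Sorted (up l)
up-sorted = map⁺ ∘ AllPairs.map s<s

upN-sorted : ∀ i {l} → Sorted l → Sorted (upN i l)
upN-sorted zero = id
upN-sorted (suc i) = up-sorted ∘ upN-sorted i

≡ᵇ≡≤ᵇ∧≥ᵇ : ∀ m n → (m ≡ᵇ n) ≡ (m ≤ᵇ n) ∧ (n ≤ᵇ m)
≡ᵇ≡≤ᵇ∧≥ᵇ zero zero = refl
≡ᵇ≡≤ᵇ∧≥ᵇ zero (suc n) = refl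
≡ᵇ≡≤ᵇ∧≥ᵇ (suc m) zero = refl
≡ᵇ≡≤ᵇ∧≥ᵇ (suc m) (suc n) =
  trans (≡ᵇ≡≤ᵇ∧≥ᵇ m n) (cong₂ _∧_ (≤ᵇ≡<ᵇ-suc m n) (≤ᵇ≡<ᵇ-suc n m))

∈ᵇ-⟦⟧ : ∀ i l → i ∈ᵇ l ≡ ⟦ l ⟧ i
∈ᵇ-⟦⟧ i [] = refl
∈ᵇ-⟦⟧ i (k ∷ l) = trans unfold (cong₂ _∨_ (sym (≡ᵇ≡≤ᵇ∧≥ᵇ i k)) (∈ᵇ-⟦⟧ i l))
  where
  unfold : i ∈ᵇ (k ∷ l) ≡ ((i ≤ᵇ k) ∧ (k ≤ᵇ i)) ∨ (i ∈ᵇ l)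
  unfold with i ≤ᵇ k | k ≤ᵇ i
  ... | true  | true  = refl
  ... | true  | false = refl
  ... | false | true  = refl
  ... | false | false = refl

module _ (i : ℕ) (ℓ : LType) where

  ltF-⟦⟧ : ⟦ ltF i ℓ ⟧ ≗ (_<ᵇ i) ∩ ⟦ ℓ ⟧
  ltF-⟦⟧ = filterᵇ-⟦⟧ (_<ᵇ i) ℓ

  up-geF-⟦⟧ : ⟦ up (geF i ℓ) ⟧ ≗ upˢ ((i ≤ᵇ_) ∩ ⟦ ℓ ⟧)
  up-geF-⟦⟧ k = trans (up-⟦⟧ (geF i ℓ) k) (reindex-cong upˢ-reindexing (filterᵇ-⟦⟧ (i ≤ᵇ_) ℓ) k)

  dec-gtF-⟦⟧ : ∀ {d} → dec (gtF i ℓ) ≡ just d → ⟦ d ⟧ ≗ ((i <ᵇ_) ∩ ⟦ ℓ ⟧) ∘ suc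
  dec-gtF-⟦⟧ e k = trans (dec-⟦⟧ (gtF i ℓ) e k) (filterᵇ-⟦⟧ (i <ᵇ_) ℓ (suc k))

  shift-rule-⟦⟧ : ∀ {ℓ'} → merge (ltF i ℓ) (up (geF i ℓ)) ≡ just ℓ' → ⟦ ℓ' ⟧ ≗ shiftˢ i ⟦ ℓ ⟧
  shift-rule-⟦⟧ {ℓ'} e k = begin
    ⟦ ℓ' ⟧ k                                       ≡⟨ merge-⟦⟧ (ltF i ℓ) (up (geF i ℓ)) e k ⟩
    ⟦ ltF i ℓ ⟧ k ∨ ⟦ up (geF i ℓ) ⟧ k             ≡⟨ cong₂ _∨_ (ltF-⟦⟧ k) (up-geF-⟦⟧ k) ⟩
    ((_<ᵇ i) ∩ ⟦ ℓ ⟧) k ∨ upˢ ((i ≤ᵇ_) ∩ ⟦ ℓ ⟧) k ≡⟨ shiftˢ-split i ⟦ ℓ ⟧ k ⟩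
    shiftˢ i ⟦ ℓ ⟧ k                               ∎
    where open ≡-Reasoning

  remove-rule-⟦⟧ : ∀ {d m} → dec (gtF i ℓ) ≡ just d → merge (ltF i ℓ) d ≡ just m →
                   ⟦ m ⟧ ≗ removeˢ i ⟦ ℓ ⟧
  remove-rule-⟦⟧ {d} {m} e₁ e₂ k = begin
    ⟦ m ⟧ k                                           ≡⟨ merge-⟦⟧ (ltF i ℓ) d e₂ k ⟩
    ⟦ ltF i ℓ ⟧ k ∨ ⟦ d ⟧ k                           ≡⟨ cong₂ _∨_ (ltF-⟦⟧ k) (dec-gtF-⟦⟧ e₁ k) ⟩
    ((_<ᵇ i) ∩ ⟦ ℓ ⟧) k ∨ (((i <ᵇ_) ∩ ⟦ ℓ ⟧) ∘ suc) k ≡⟨ removeˢ-split i ⟦ ℓ ⟧ k ⟩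
    removeˢ i ⟦ ℓ ⟧ k                                 ∎
    where open ≡-Reasoning

  module _ (sℓ : Sorted ℓ) where

    shift-rule-sorted : ∀ {ℓ'} → merge (ltF i ℓ) (up (geF i ℓ)) ≡ just ℓ' → Sorted ℓ'
    shift-rule-sorted = merge-sorted (filterᵇ-sorted _ sℓ) (up-sorted (filterᵇ-sorted _ sℓ))

    shift-rule-defined : ∃[ ℓ' ] merge (ltF i ℓ) (up (geF i ℓ)) ≡ just ℓ'
    shift-rule-defined =
      merge-defined _ _ (filterᵇ-sorted _ sℓ) (up-sorted (filterᵇ-sorted _ sℓ))
        (disjointˢ⇒disjoint (ltF i ℓ) (up (geF i ℓ))
          (disjoint-mono (≗⇒⊆ ltF-⟦⟧) (≗⇒⊆ up-geF-⟦⟧) (shiftˢ-split-disjoint i ⟦ ℓ ⟧)))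

    remove-rule-sorted : ∀ {d m} → dec (gtF i ℓ) ≡ just d → merge (ltF i ℓ) d ≡ just m → Sorted m
    remove-rule-sorted e₁ = merge-sorted (filterᵇ-sorted _ sℓ) (dec-sorted (filterᵇ-sorted _ sℓ) e₁)

    remove-rule-defined : ∃[ d ] ∃[ m ] dec (gtF i ℓ) ≡ just d × merge (ltF i ℓ) d ≡ just m
    remove-rule-defined =
      let d , e₁ = dec-defined (gtF i ℓ) (proj₂ ∘ ∈-filter⁻ (T? ∘ (i <ᵇ_)) {xs = ℓ})
          m , e₂ = merge-defined _ _ (filterᵇ-sorted _ sℓ) (dec-sorted (filterᵇ-sorted _ sℓ) e₁)
                     (disjointˢ⇒disjoint (ltF i ℓ) d (disjoint-mono (≗⇒⊆ ltF-⟦⟧) (≗⇒⊆ (dec-gtF-⟦⟧ e₁))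
                       (removeˢ-split-disjoint i ⟦ ℓ ⟧)))
      in d , m , e₁ , e₂

typing-sorted : ∀ {t ℓ} → t ∶ ℓ → Sorted ℓ
typing-sorted (ty-var n) = All.[] ∷ []
typing-sorted (ty-lam d e) with typing-sorted d
... | _ ∷ sℓ = dec-sorted sℓ e
typing-sorted (ty-app d₁ d₂ e) = merge-sorted (typing-sorted d₁) (typing-sorted d₂) e
typing-sorted (ty-shift i d e) = shift-rule-sorted i _ (typing-sorted d) e
typing-sorted (ty-sub-in i d₁ d₂ _ e₁ e₂ e₃) =
  merge-sorted (remove-rule-sorted i _ (typing-sorted d₁) e₁ e₂) (upN-sorted i (typing-sorted d₂)) e₃
typing-sorted (ty-sub-out i d₁ _ _ e₁ e₂) = remove-rule-sorted i _ (typing-sorted d₁) e₁ e₂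

_⊨_ : Term → Indices → Set
var n ⊨ R = R ≗ ⟦ n ∷ [] ⟧
lam t ⊨ R = ∃[ P ] t ⊨ P × 0 ∈ˢ P × R ≗ P ∘ suc
app t s ⊨ R = ∃[ P ] ∃[ Q ] t ⊨ P × s ⊨ Q × Disjointˢ P Q × R ≗ P ∪ Q
shift t i ⊨ R = ∃[ P ] t ⊨ P × R ≗ shiftˢ i P
sub t s i ⊨ R = ∃[ P ] ∃[ Q ] t ⊨ P × s ⊨ Q × Substitutable i P Q × R ≗ substˢ i P Q

∶⇒⊨ : ∀ {t ℓ} → t ∶ ℓ → t ⊨ ⟦ ℓ ⟧
∶⇒⊨ (ty-var n) _ = refl
∶⇒⊨ (ty-lam {ℓ = ℓ} d e) = ⟦ 0 ∷ ℓ ⟧ , ∶⇒⊨ d , _ , dec-⟦⟧ ℓ e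
∶⇒⊨ (ty-app {ℓ₁ = ℓ₁} {ℓ₂} d₁ d₂ e) =
  ⟦ ℓ₁ ⟧ , ⟦ ℓ₂ ⟧ , ∶⇒⊨ d₁ , ∶⇒⊨ d₂ ,
  disjoint⇒disjointˢ ℓ₁ ℓ₂ (merge-disjoint (typing-sorted d₁) (typing-sorted d₂) e) , merge-⟦⟧ ℓ₁ ℓ₂ e
∶⇒⊨ (ty-shift {ℓ = ℓ} i d e) = ⟦ ℓ ⟧ , ∶⇒⊨ d , shift-rule-⟦⟧ i ℓ e
∶⇒⊨ (ty-sub-in {ℓ₁ = ℓ₁} {ℓ₂} {m = m} {ℓ} i d₁ d₂ i∈ℓ₁ e₁ e₂ e₃) =
  ⟦ ℓ₁ ⟧ , ⟦ ℓ₂ ⟧ , ∶⇒⊨ d₁ , ∶⇒⊨ d₂ , ok , ℓ≗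
  where
  m≗ : ⟦ m ⟧ ≗ removeˢ i ⟦ ℓ₁ ⟧
  m≗ = remove-rule-⟦⟧ i ℓ₁ e₁ e₂
  ok : Substitutable i ⟦ ℓ₁ ⟧ ⟦ ℓ₂ ⟧
  ok = disjoint-mono (≗⇒⊆ (sym ∘ m≗)) (λ k → ≗⇒⊆ (sym ∘ upN-⟦⟧ i ℓ₂) k ∘ when-⊆ (upNˢ i ⟦ ℓ₂ ⟧) k)
    (disjoint⇒disjointˢ m (upN i ℓ₂) (merge-disjoint
      (remove-rule-sorted i ℓ₁ (typing-sorted d₁) e₁ e₂) (upN-sorted i (typing-sorted d₂)) e₃))
  ℓ≗ : ⟦ ℓ ⟧ ≗ substˢ i ⟦ ℓ₁ ⟧ ⟦ ℓ₂ ⟧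
  ℓ≗ k = trans (merge-⟦⟧ m (upN i ℓ₂) e₃ k) (trans (cong₂ _∨_ (m≗ k) (upN-⟦⟧ i ℓ₂ k))
    (sym (substˢ-in i (trans (sym (∈ᵇ-⟦⟧ i ℓ₁)) i∈ℓ₁) k)))
∶⇒⊨ (ty-sub-out {ℓ₁ = ℓ₁} {ℓ₂} i d₁ d₂ i∉ℓ₁ e₁ e₂) =
  ⟦ ℓ₁ ⟧ , ⟦ ℓ₂ ⟧ , ∶⇒⊨ d₁ , ∶⇒⊨ d₂ , ok , λ k →
  trans (remove-rule-⟦⟧ i ℓ₁ e₁ e₂ k) (sym (substˢ-out i ℓ₁[i]≡false k))
  where
  ℓ₁[i]≡false : ⟦ ℓ₁ ⟧ i ≡ false
  ℓ₁[i]≡false = trans (sym (∈ᵇ-⟦⟧ i ℓ₁)) i∉ℓ₁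
  ok : Substitutable i ⟦ ℓ₁ ⟧ ⟦ ℓ₂ ⟧
  ok k _ k∈ = subst T ℓ₁[i]≡false (proj₁ (to T-∧ k∈))

_∶ˢ_ : Term → Indices → Set
t ∶ˢ R = ∃[ ℓ ] t ∶ ℓ × Sorted ℓ × ⟦ ℓ ⟧ ≗ R

∶ˢ-lam : ∀ {t P R} → t ∶ˢ P → 0 ∈ˢ P → R ≗ P ∘ suc → lam t ∶ˢ R
∶ˢ-lam ([] , _ , _ , ℓ≗P) 0∈P _ = ⊥-elim (≗⇒⊆ (sym ∘ ℓ≗P) 0 0∈P)
∶ˢ-lam (x ∷ ℓ , d , sxℓ@(x<ℓ ∷ sℓ) , xℓ≗P) 0∈P R≗
  with n≤0⇒n≡0 (head-≤ sxℓ (∈ˢ⇒∈ (x ∷ ℓ) (≗⇒⊆ (sym ∘ xℓ≗P) 0 0∈P)))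
... | refl with dec-defined ℓ (<-irrefl refl ∘ All.lookup x<ℓ)
...   | ℓ' , e = ℓ' , ty-lam d e , dec-sorted sℓ e , λ k →
  trans (dec-⟦⟧ ℓ e k) (trans (xℓ≗P (suc k)) (sym (R≗ k)))

∶ˢ-app : ∀ {t s P Q R} → t ∶ˢ P → s ∶ˢ Q → Disjointˢ P Q → R ≗ P ∪ Q → app t s ∶ˢ R
∶ˢ-app (ℓ₁ , d₁ , s₁ , ℓ₁≗P) (ℓ₂ , d₂ , s₂ , ℓ₂≗Q) P#Q R≗
  with merge-defined ℓ₁ ℓ₂ s₁ s₂
         (disjointˢ⇒disjoint ℓ₁ ℓ₂ (disjoint-mono (≗⇒⊆ ℓ₁≗P) (≗⇒⊆ ℓ₂≗Q) P#Q))
... | ℓ , e = ℓ , ty-app d₁ d₂ e , merge-sorted s₁ s₂ e , λ k →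
  trans (merge-⟦⟧ ℓ₁ ℓ₂ e k) (trans (cong₂ _∨_ (ℓ₁≗P k) (ℓ₂≗Q k)) (sym (R≗ k)))

∶ˢ-shift : ∀ {t P R} i → t ∶ˢ P → R ≗ shiftˢ i P → shift t i ∶ˢ R
∶ˢ-shift i (ℓ , d , sℓ , ℓ≗P) R≗ with shift-rule-defined i ℓ sℓ
... | ℓ' , e = ℓ' , ty-shift i d e , shift-rule-sorted i ℓ sℓ e , λ k →
  trans (shift-rule-⟦⟧ i ℓ e k) (trans (reindex-cong (shiftˢ-reindexing i) ℓ≗P k) (sym (R≗ k)))

∶ˢ-sub : ∀ {t s P Q R} i → t ∶ˢ P → s ∶ˢ Q → Substitutable i P Q → R ≗ substˢ i P Q →
         sub t s i ∶ˢ R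
∶ˢ-sub {t} {s} {P} {Q} {R} i (ℓ₁ , d₁ , s₁ , ℓ₁≗P) (ℓ₂ , d₂ , s₂ , ℓ₂≗Q) ok R≗
  with remove-rule-defined i ℓ₁ s₁
... | d , m , e₁ , e₂ = by-membership (i ∈ᵇ ℓ₁) refl
  where
  sm : Sorted m
  sm = remove-rule-sorted i ℓ₁ s₁ e₁ e₂
  m≗ : ⟦ m ⟧ ≗ removeˢ i P
  m≗ k = trans (remove-rule-⟦⟧ i ℓ₁ e₁ e₂ k) (reindex-cong (removeˢ-reindexing i) ℓ₁≗P k)
  up≗ : ⟦ upN i ℓ₂ ⟧ ≗ upNˢ i Q
  up≗ k = trans (upN-⟦⟧ i ℓ₂ k) (reindex-cong (upNˢ-reindexing i) ℓ₂≗Q k)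
  P[i]≡ : ∀ {b} → i ∈ᵇ ℓ₁ ≡ b → P i ≡ b
  P[i]≡ i∈?ℓ₁ = trans (sym (ℓ₁≗P i)) (trans (sym (∈ᵇ-⟦⟧ i ℓ₁)) i∈?ℓ₁)
  by-membership : ∀ b → i ∈ᵇ ℓ₁ ≡ b → sub t s i ∶ˢ R
  by-membership false i∉ℓ₁ = m , ty-sub-out i d₁ d₂ i∉ℓ₁ e₁ e₂ , sm , λ k →
    trans (m≗ k) (trans (sym (substˢ-out i {P} {Q} (P[i]≡ i∉ℓ₁) k)) (sym (R≗ k)))
  by-membership true i∈ℓ₁ with merge-defined m (upN i ℓ₂) sm (upN-sorted i s₂)
    (disjointˢ⇒disjoint m (upN i ℓ₂) (disjoint-mono (≗⇒⊆ m≗)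
      (λ k → ≗⇒⊆ (sym ∘ when-T (upNˢ i Q) (from T-≡ (P[i]≡ i∈ℓ₁))) k ∘ ≗⇒⊆ up≗ k) ok))
  ... | ℓ , e₃ = ℓ , ty-sub-in i d₁ d₂ i∈ℓ₁ e₁ e₂ e₃ , merge-sorted sm (upN-sorted i s₂) e₃ , λ k →
    trans (merge-⟦⟧ m (upN i ℓ₂) e₃ k) (trans (cong₂ _∨_ (m≗ k) (up≗ k))
      (trans (sym (substˢ-in i {P} {Q} (P[i]≡ i∈ℓ₁) k)) (sym (R≗ k))))

⊨⇒∶ˢ : ∀ t {R} → t ⊨ R → t ∶ˢ R
⊨⇒∶ˢ (var n) R≗ = n ∷ [] , ty-var n , All.[] ∷ [] , sym ∘ R≗
⊨⇒∶ˢ (lam t) (_ , ⊨t , 0∈P , R≗) = ∶ˢ-lam (⊨⇒∶ˢ t ⊨t) 0∈P R≗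
⊨⇒∶ˢ (app t s) (_ , _ , ⊨t , ⊨s , P#Q , R≗) = ∶ˢ-app (⊨⇒∶ˢ t ⊨t) (⊨⇒∶ˢ s ⊨s) P#Q R≗
⊨⇒∶ˢ (shift t i) (_ , ⊨t , R≗) = ∶ˢ-shift i (⊨⇒∶ˢ t ⊨t) R≗
⊨⇒∶ˢ (sub t s i) (_ , _ , ⊨t , ⊨s , ok , R≗) = ∶ˢ-sub i (⊨⇒∶ˢ t ⊨t) (⊨⇒∶ˢ s ⊨s) ok R≗

upˢ-var : ∀ n → upˢ ⟦ n ∷ [] ⟧ ≗ ⟦ suc n ∷ [] ⟧
upˢ-var n zero = refl
upˢ-var n (suc k) = refl

shiftˢ-suc-var-zero : ∀ i → shiftˢ (suc i) ⟦ 0 ∷ [] ⟧ ≗ ⟦ 0 ∷ [] ⟧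
shiftˢ-suc-var-zero i zero = refl
shiftˢ-suc-var-zero i (suc k) = reindex-∅ (shiftˢ-reindexing i) k

shiftˢ-suc-var-suc : ∀ i n → shiftˢ (suc i) ⟦ suc n ∷ [] ⟧ ≗ upˢ (shiftˢ i ⟦ n ∷ [] ⟧)
shiftˢ-suc-var-suc i n zero = refl
shiftˢ-suc-var-suc i n (suc k) = refl

substˢ-zero-var-suc : ∀ n Q → substˢ 0 ⟦ suc n ∷ [] ⟧ Q ≗ ⟦ n ∷ [] ⟧
substˢ-zero-var-suc n Q k = ∨-identityʳ _

substˢ-suc-var-zero : ∀ i Q → substˢ (suc i) ⟦ 0 ∷ [] ⟧ Q ≗ ⟦ 0 ∷ [] ⟧
substˢ-suc-var-zero i Q zero = refl
substˢ-suc-var-zero i Q (suc k) = trans (∨-identityʳ _) (reindex-∅ (removeˢ-reindexing i) k)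

substˢ-suc-var-suc : ∀ i n Q → substˢ (suc i) ⟦ suc n ∷ [] ⟧ Q ≗ upˢ (substˢ i ⟦ n ∷ [] ⟧ Q)
substˢ-suc-var-suc i n Q zero = ∧-zeroʳ _
substˢ-suc-var-suc i n Q (suc k) = refl

⊨-resp : ∀ t {R R'} → R ≗ R' → t ⊨ R → t ⊨ R'
⊨-resp (var n) R≗R' R≗ k = trans (sym (R≗R' k)) (R≗ k)
⊨-resp (lam t) R≗R' (P , ⊨t , 0∈P , R≗) = P , ⊨t , 0∈P , λ k → trans (sym (R≗R' k)) (R≗ k)
⊨-resp (app t s) R≗R' (P , Q , ⊨t , ⊨s , P#Q , R≗) =
  P , Q , ⊨t , ⊨s , P#Q , λ k → trans (sym (R≗R' k)) (R≗ k)
⊨-resp (shift t i) R≗R' (P , ⊨t , R≗) = P , ⊨t , λ k → trans (sym (R≗R' k)) (R≗ k)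
⊨-resp (sub t s i) R≗R' (P , Q , ⊨t , ⊨s , ok , R≗) =
  P , Q , ⊨t , ⊨s , ok , λ k → trans (sym (R≗R' k)) (R≗ k)

⊨-sub-app : ∀ {t₁ t₂ s i R} → sub (app t₁ t₂) s i ⊨ R → app (sub t₁ s i) (sub t₂ s i) ⊨ R
⊨-sub-app {i = i} (_ , Q , (P₁ , P₂ , ⊨t₁ , ⊨t₂ , P₁#P₂ , P≗) , ⊨s , ok , R≗) =
  substˢ i P₁ Q , substˢ i P₂ Q ,
  (P₁ , Q , ⊨t₁ , ⊨s , substitutable-mono i (∈-∪⁺ˡ {P₁} {P₂}) ok' , λ _ → refl) ,
  (P₂ , Q , ⊨t₂ , ⊨s , substitutable-mono i (∈-∪⁺ʳ {P₁} {P₂}) ok' , λ _ → refl) ,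
  substˢ-disjoint i P₁#P₂ ok' ,
  λ k → trans (R≗ k) (trans (substˢ-cong i Q P≗ k) (substˢ-∪ i P₁ P₂ Q k))
  where
  ok' : Substitutable i (P₁ ∪ P₂) Q
  ok' = substitutable-mono i (≗⇒⊆ (sym ∘ P≗)) ok

⊨-sub-lam : ∀ {t s i R} → sub (lam t) s i ⊨ R → lam (sub t s (suc i)) ⊨ R
⊨-sub-lam {i = i} (_ , Q , (P' , ⊨t , 0∈P' , P≗) , ⊨s , ok , R≗) =
  substˢ (suc i) P' Q ,
  (P' , Q , ⊨t , ⊨s , substitutable-suc i (substitutable-mono i (≗⇒⊆ (sym ∘ P≗)) ok) , λ _ → refl) ,
  from T-∨ (inj₁ 0∈P') , λ k → trans (R≗ k) (substˢ-cong i Q P≗ k)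

⊨-reduction : ∀ {t t' R} → t ⟶ t' → t ⊨ R → t' ⊨ R
⊨-reduction (beta t₁ t₂) (_ , Q , (P' , ⊨t₁ , 0∈P' , P≗) , ⊨t₂ , P#Q , R≗) =
  P' , Q , ⊨t₁ , ⊨t₂ , disjoint-mono (≗⇒⊆ (sym ∘ P≗)) (when-⊆ Q) P#Q ,
  λ k → trans (R≗ k) (cong₂ _∨_ (P≗ k) (sym (when-T Q 0∈P' k)))
⊨-reduction (shift-app t₁ t₂ i) (_ , (P₁ , P₂ , ⊨t₁ , ⊨t₂ , P₁#P₂ , P≗) , R≗) =
  shiftˢ i P₁ , shiftˢ i P₂ , (P₁ , ⊨t₁ , λ _ → refl) , (P₂ , ⊨t₂ , λ _ → refl) ,
  reindex-disjoint ρ P₁#P₂ , λ k → trans (R≗ k) (trans (reindex-cong ρ P≗ k) (reindex-∪ ρ P₁ P₂ k))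
  where ρ = shiftˢ-reindexing i
⊨-reduction (sub-app t₁ t₂ t₃ i) = ⊨-sub-app
⊨-reduction (shift-lam t i) (_ , (P' , ⊨t , 0∈P' , P≗) , R≗) =
  shiftˢ (suc i) P' , (P' , ⊨t , λ _ → refl) , 0∈P' ,
  λ k → trans (R≗ k) (reindex-cong (shiftˢ-reindexing i) P≗ k)
⊨-reduction (sub-lam t₁ t₂ i) = ⊨-sub-lam
⊨-reduction (sub-0-0 t) (_ , Q , P≗ , ⊨t , _ , R≗) =
  ⊨-resp t (λ k → sym (trans (R≗ k) (substˢ-cong 0 Q P≗ k))) ⊨t
⊨-reduction (sub-S-0 n t) (_ , Q , P≗ , _ , _ , R≗) k =
  trans (R≗ k) (trans (substˢ-cong 0 Q P≗ k) (substˢ-zero-var-suc n Q k))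
⊨-reduction (sub-0-S t i) (_ , Q , P≗ , _ , _ , R≗) k =
  trans (R≗ k) (trans (substˢ-cong (suc i) Q P≗ k) (substˢ-suc-var-zero i Q k))
⊨-reduction (sub-S-S n t i) (_ , Q , P≗ , ⊨t , ok , R≗) =
  substˢ i ⟦ n ∷ [] ⟧ Q ,
  (⟦ n ∷ [] ⟧ , Q , (λ _ → refl) , ⊨t ,
   substitutable-suc⁻ i (substitutable-mono (suc i) (≗⇒⊆ (sym ∘ P≗)) ok) , λ _ → refl) ,
  λ k → trans (R≗ k) (trans (substˢ-cong (suc i) Q P≗ k) (substˢ-suc-var-suc i n Q k))
⊨-reduction (shift-0-S i) (_ , P≗ , R≗) k =
  trans (R≗ k) (trans (reindex-cong (shiftˢ-reindexing (suc i)) P≗ k) (shiftˢ-suc-var-zero i k))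
⊨-reduction (shift-S-S n i) (_ , P≗ , R≗) =
  shiftˢ i ⟦ n ∷ [] ⟧ , (⟦ n ∷ [] ⟧ , (λ _ → refl) , λ _ → refl) ,
  λ k → trans (R≗ k) (trans (reindex-cong (shiftˢ-reindexing (suc i)) P≗ k) (shiftˢ-suc-var-suc i n k))
⊨-reduction (shift-0 n) (_ , P≗ , R≗) k =
  trans (R≗ k) (trans (reindex-cong upˢ-reindexing P≗ k) (upˢ-var n k))
⊨-reduction (c-lam r) (P , ⊨t , 0∈P , R≗) = P , ⊨-reduction r ⊨t , 0∈P , R≗
⊨-reduction (c-appˡ r) (P , Q , ⊨t , ⊨s , P#Q , R≗) = P , Q , ⊨-reduction r ⊨t , ⊨s , P#Q , R≗
⊨-reduction (c-appʳ r) (P , Q , ⊨t , ⊨s , P#Q , R≗) = P , Q , ⊨t , ⊨-reduction r ⊨s , P#Q , R≗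
⊨-reduction (c-shift r) (P , ⊨t , R≗) = P , ⊨-reduction r ⊨t , R≗
⊨-reduction (c-subˡ r) (P , Q , ⊨t , ⊨s , ok , R≗) = P , Q , ⊨-reduction r ⊨t , ⊨s , ok , R≗
⊨-reduction (c-subʳ r) (P , Q , ⊨t , ⊨s , ok , R≗) = P , Q , ⊨t , ⊨-reduction r ⊨s , ok , R≗

subject-reduction : ∀ {t t' ℓ} → t ∶ ℓ → t ⟶ t' → t' ∶ ℓ
subject-reduction {t' = t'} d r with ⊨⇒∶ˢ t' (⊨-reduction r (∶⇒⊨ d))
... | ℓ' , d' , sℓ' , ℓ'≗ℓ = subst (t' ∶_) (⟦⟧-injective sℓ' (typing-sorted d) ℓ'≗ℓ) d'

corollary1 : (t t' : Term) → Linear t → t ⟶ t' → Linear t'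
corollary1 _ _ = subject-reduction
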